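{- Let $G$ be a graph and let $a,k$ be positive integers with $a\le|V(G)|$. If $|N_G(A)|\ge k$ for all subsets $A\subseteq V(G)$ with $|A|=a$, then $\mathrm{bcw}_1(G)>k$.
   Context: All graphs are finite, simple and undirected. For $A\subseteq V(G)$, $N_G(A)=\bigcup_{u\in A}N_G(u)\setminus A$. For radius-$1$ blind cop-width: a blind strategy is a sequence $C_1,\dots,C_m\subseteq V(G)$ using $\max_i|C_i|$ cops, with $A_1=V(G)\setminus C_1$ and $A_{i+1}$ the set of $u\in V(G)\setminus C_{i+1}$ reachable from some vertex of $A_i$ by a path of length at most $1$ (length $0$ allowed) in $G\setminus(C_i\cap C_{i+1})$; it is winning if $A_m=\emptyset$. $\mathrm{bcw}_1(G)$ is the minimum number of cops of a winning strategy. -}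

module Defs where

open import Data.Nat using (ℕ; _⊔_; _<_)
open import Data.Bool using (Bool; true; false; if_then_else_)
open import Data.Fin using (Fin)
open import Data.Vec using (tabulate; lookup)
open import Data.List as List using (List; []; _∷_; allFin)
open import Data.Fin.Subset using (Subset; _∈_; _∉_; _∩_; _─_; ⋃; ∣_∣; ⊥)
open import Data.Product using (_×_; ∃)
open import Data.Sum using (_⊎_)
open import Relation.Binary.PropositionalEquality using (_≡_)
open import Relation.Nullary using (¬_)

record Graph : Set where
  field
    n     : ℕ
    adj   : Fin n → Fin n → Bool
    sym   : ∀ u v → adj u v ≡ adj v u
    irrefl : ∀ u → adj u u ≡ false

open Graph public

N₁ : (G : Graph) → Fin (n G) → Subset (n G)
N₁ G u = tabulate (adj G u)

N : (G : Graph) → Subset (n G) → Subset (n G)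
N G A = ⋃ (List.map (λ u → if lookup A u then N₁ G u else ⊥) (allFin (n G))) ─ A

-- One step of the robber territory:
-- A_{i+1} = { u ∉ C_{i+1} | ∃ v ∈ A_i, path of length ≤ 1 from v to u in G ∖ (C_i ∩ C_{i+1}) }
step : (G : Graph) → Subset (n G) → Subset (n G) → (Fin (n G) → Set) → (Fin (n G) → Set)
step G Cᵢ Cⱼ A u =
  u ∉ Cⱼ × ∃ λ v → A v ×
    (v ≡ u ⊎ (adj G v u ≡ true × v ∉ (Cᵢ ∩ Cⱼ) × u ∉ (Cᵢ ∩ Cⱼ)))

territory : (G : Graph) → Subset (n G) → (Fin (n G) → Set) → List (Subset (n G)) → (Fin (n G) → Set)
territory G C A []        = A
territory G C A (C' ∷ Cs) = territory G C' (step G C C' A) Cs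

-- A blind strategy is a nonempty sequence C₁, C₂, …, C_m, given as C₁ and the list [C₂,…,C_m].
-- A₁ = V(G) ∖ C₁; winning iff A_m = ∅.
Winning : (G : Graph) → Subset (n G) → List (Subset (n G)) → Set
Winning G C₁ Cs = ∀ u → ¬ territory G C₁ (λ u → u ∉ C₁) Cs u

cops : {m : ℕ} → Subset m → List (Subset m) → ℕ
cops C₁ Cs = List.foldr (λ C k → ∣ C ∣ ⊔ k) ∣ C₁ ∣ Cs

-- bcw₁(G) > k  iff  every winning blind strategy uses more than k cops
-- (bcw₁(G) is the minimum number of cops over winning strategies; one always exists, e.g. C₁ = V(G)).
bcw₁> : Graph → ℕ → Set
bcw₁> G k = (C₁ : Subset (n G)) (Cs : List (Subset (n G))) → Winning G C₁ Cs → k < cops C₁ Cs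

-- While the cops hold at most k vertices, the robber territory always contains a cop-free
-- set of at least a vertices. Indeed, inside such a set pick S with |S| = a: the robber can
-- stay on S or move to N(S) (a vertex of S is never guarded in both rounds, a vertex of
-- N(S) is never guarded in the new round), |S ∪ N(S)| ≥ a + k, and the new cops remove at
-- most k of these vertices. The same count with S ∪ N(S) ⊆ V(G) gives |V(G) ∖ C₁| ≥ a.
module Submission where

open import Defs hiding (sym)
open import Data.Nat using (ℕ; zero; suc; _+_; _≤_; _<_; _≤?_; z≤n; s≤s)
open import Data.Nat.Properties
  using (≤-trans; +-suc; n≤1+n; +-monoʳ-≤; +-cancelʳ-≤; m⊔n≤o⇒m≤o; m⊔n≤o⇒n≤o; ≰⇒>; >⇒≢)
open import Data.Fin using (Fin)
open import Data.Fin.Subset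
  using (Subset; _∈_; _∉_; _⊆_; _∪_; _∩_; _─_; ⋃; ⊤; ⊥; ∣_∣; Nonempty)
open import Data.Fin.Subset.Properties
  using (x∈p∪q⁻; x∈p∩q⁻; p─q⊆p; ∉⊥; ∣⊥∣≡0; ∣p∣≤n; ∣⊤∣≡n; nonempty?; Empty-unique)
open import Data.Vec using ([]; _∷_; here; there; lookup; tabulate)
open import Data.Vec.Properties using ([]=⇒lookup; lookup⇒[]=; lookup∘tabulate)
open import Data.Bool using (Bool; true; false; if_then_else_)
open import Data.List as List using (List; []; _∷_)
open import Data.List.Relation.Unary.All using (All; []; _∷_)
open import Data.Product using (∃; _×_; _,_; proj₁; proj₂)
open import Data.Sum using (inj₁; inj₂)
open import Data.Empty using (⊥-elim)
open import Relation.Nullary using (yes; no; contradiction)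
open import Function using (_∘′_)
open import Relation.Binary.PropositionalEquality using (_≡_; refl; sym; trans; cong; subst)

x∈p─q⇒x∉q : ∀ {m} (p q : Subset m) {x} → x ∈ p ─ q → x ∉ q
x∈p─q⇒x∉q (true ∷ p) (false ∷ q) here = λ ()
x∈p─q⇒x∉q (_ ∷ p) (_ ∷ q) (there x∈p─q) (there x∈q) = x∈p─q⇒x∉q p q x∈p─q x∈q

x∈tabulate⁻ : ∀ {m} (f : Fin m → Bool) {x} → x ∈ tabulate f → f x ≡ true
x∈tabulate⁻ f {x} x∈f = trans (sym (lookup∘tabulate f x)) ([]=⇒lookup x∈f)

x∈⋃-map⁻ : ∀ {m} {A : Set} (g : A → Subset m) (xs : List A) {u} →
           u ∈ ⋃ (List.map g xs) → ∃ λ v → u ∈ g v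
x∈⋃-map⁻ g []       u∈⋃ = ⊥-elim (∉⊥ u∈⋃)
x∈⋃-map⁻ g (x ∷ xs) u∈⋃ with x∈p∪q⁻ (g x) (⋃ (List.map g xs)) u∈⋃
... | inj₁ u∈gx = x , u∈gx
... | inj₂ u∈⋃′ = x∈⋃-map⁻ g xs u∈⋃′

∣p∪[q─p]∣≡∣p∣+∣q─p∣ : ∀ {m} (p q : Subset m) → ∣ p ∪ (q ─ p) ∣ ≡ ∣ p ∣ + ∣ q ─ p ∣
∣p∪[q─p]∣≡∣p∣+∣q─p∣ []          []          = refl
∣p∪[q─p]∣≡∣p∣+∣q─p∣ (true ∷ p)  (_ ∷ q)     = cong suc (∣p∪[q─p]∣≡∣p∣+∣q─p∣ p q)
∣p∪[q─p]∣≡∣p∣+∣q─p∣ (false ∷ p) (true ∷ q)  =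
  trans (cong suc (∣p∪[q─p]∣≡∣p∣+∣q─p∣ p q)) (sym (+-suc ∣ p ∣ ∣ q ─ p ∣))
∣p∪[q─p]∣≡∣p∣+∣q─p∣ (false ∷ p) (false ∷ q) = ∣p∪[q─p]∣≡∣p∣+∣q─p∣ p q

∣p∣≤∣p─q∣+∣q∣ : ∀ {m} (p q : Subset m) → ∣ p ∣ ≤ ∣ p ─ q ∣ + ∣ q ∣
∣p∣≤∣p─q∣+∣q∣ []          []          = z≤n
∣p∣≤∣p─q∣+∣q∣ (true ∷ p)  (false ∷ q) = s≤s (∣p∣≤∣p─q∣+∣q∣ p q)
∣p∣≤∣p─q∣+∣q∣ (true ∷ p)  (true ∷ q)  =
  subst (suc ∣ p ∣ ≤_) (sym (+-suc ∣ p ─ q ∣ ∣ q ∣)) (s≤s (∣p∣≤∣p─q∣+∣q∣ p q))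
∣p∣≤∣p─q∣+∣q∣ (false ∷ p) (true ∷ q)  =
  subst (∣ p ∣ ≤_) (sym (+-suc ∣ p ─ q ∣ ∣ q ∣)) (≤-trans (∣p∣≤∣p─q∣+∣q∣ p q) (n≤1+n _))
∣p∣≤∣p─q∣+∣q∣ (false ∷ p) (false ∷ q) = ∣p∣≤∣p─q∣+∣q∣ p q

a+k≤∣p∣⇒∣q∣≤k⇒a≤∣p─q∣ : ∀ {m a k} (p q : Subset m) → a + k ≤ ∣ p ∣ → ∣ q ∣ ≤ k → a ≤ ∣ p ─ q ∣
a+k≤∣p∣⇒∣q∣≤k⇒a≤∣p─q∣ {a = a} {k} p q a+k≤∣p∣ ∣q∣≤k =
  +-cancelʳ-≤ k a ∣ p ─ q ∣
    (≤-trans a+k≤∣p∣ (≤-trans (∣p∣≤∣p─q∣+∣q∣ p q) (+-monoʳ-≤ ∣ p ─ q ∣ ∣q∣≤k)))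

subset-of-size : ∀ {m} a (p : Subset m) → a ≤ ∣ p ∣ → ∃ λ q → q ⊆ p × ∣ q ∣ ≡ a
subset-of-size {m} zero p _ = ⊥ , (λ x∈⊥ → ⊥-elim (∉⊥ x∈⊥)) , ∣⊥∣≡0 m
subset-of-size (suc a) (false ∷ p) a<∣p∣     with subset-of-size (suc a) p a<∣p∣
... | q , q⊆p , ∣q∣≡a = false ∷ q , (λ { (there x∈q) → there (q⊆p x∈q) }) , ∣q∣≡a
subset-of-size (suc a) (true ∷ p)  (s≤s a≤∣p∣) with subset-of-size a p a≤∣p∣
... | q , q⊆p , ∣q∣≡a =
  true ∷ q , (λ { here → here ; (there x∈q) → there (q⊆p x∈q) }) , cong suc ∣q∣≡a

0<∣p∣⇒Nonempty : ∀ {m} (p : Subset m) → 0 < ∣ p ∣ → Nonempty p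
0<∣p∣⇒Nonempty {m} p 0<∣p∣ with nonempty? p
... | yes p≢∅ = p≢∅
... | no  p≡∅ = contradiction (trans (cong ∣_∣ (Empty-unique p≡∅)) (∣⊥∣≡0 m)) (>⇒≢ 0<∣p∣)

cops≤k⇒All≤k : ∀ {m k} (C₁ : Subset m) Cs → cops C₁ Cs ≤ k → ∣ C₁ ∣ ≤ k × All (λ C → ∣ C ∣ ≤ k) Cs
cops≤k⇒All≤k C₁ []       ∣C₁∣≤k = ∣C₁∣≤k , []
cops≤k⇒All≤k C₁ (C ∷ Cs) ≤k     with cops≤k⇒All≤k C₁ Cs (m⊔n≤o⇒n≤o ∣ C ∣ _ ≤k)
... | ∣C₁∣≤k , Cs≤k = ∣C₁∣≤k , m⊔n≤o⇒m≤o ∣ C ∣ _ ≤k ∷ Cs≤k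

module _ (G : Graph) where

  Territory : Set₁
  Territory = Fin (n G) → Set

  x∈N⇒adjacent : (S : Subset (n G)) {u : Fin (n G)} → u ∈ N G S →
                 ∃ λ v → v ∈ S × adj G v u ≡ true
  x∈N⇒adjacent S u∈NS
    with x∈⋃-map⁻ (λ v → if lookup S v then N₁ G v else ⊥) (List.allFin (n G)) (p─q⊆p _ S u∈NS)
  ... | v , u∈Nv with lookup S v in v∈S
  ...   | true  = v , lookup⇒[]= v S v∈S , x∈tabulate⁻ (adj G v) u∈Nv
  ...   | false = ⊥-elim (∉⊥ u∈Nv)

  LargeCopFree : ℕ → Subset (n G) → Territory → Set
  LargeCopFree a C A = ∃ λ S → a ≤ ∣ S ∣ × (∀ {u} → u ∈ S → A u) × (∀ {u} → u ∈ S → u ∉ C)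

  closure─C′⊆step : ∀ {C C′ A} (S : Subset (n G)) →
                    (∀ {u} → u ∈ S → A u) → (∀ {u} → u ∈ S → u ∉ C) →
                    ∀ {u} → u ∈ (S ∪ N G S) ─ C′ → step G C C′ A u
  closure─C′⊆step {C} {C′} S S⊆A S∩C≡∅ {u} u∈T
    with x∈p∪q⁻ S (N G S) (p─q⊆p _ C′ u∈T)
  ... | inj₁ u∈S  = u∉C′ , u , S⊆A u∈S , inj₁ refl
    where u∉C′ = x∈p─q⇒x∉q _ C′ u∈T
  ... | inj₂ u∈NS with x∈N⇒adjacent S u∈NS
  ...   | v , v∈S , v~u = u∉C′ , v , S⊆A v∈S , inj₂ (v~u , v∉C∩C′ , u∉C∩C′)
    where
    u∉C′ = x∈p─q⇒x∉q _ C′ u∈T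
    v∉C∩C′ : v ∉ C ∩ C′
    v∉C∩C′ v∈C∩C′ = S∩C≡∅ v∈S (proj₁ (x∈p∩q⁻ C C′ v∈C∩C′))
    u∉C∩C′ : u ∉ C ∩ C′
    u∉C∩C′ u∈C∩C′ = u∉C′ (proj₂ (x∈p∩q⁻ C C′ u∈C∩C′))

module _ (G : Graph) (a k : ℕ) (expanding : (A : Subset (n G)) → ∣ A ∣ ≡ a → k ≤ ∣ N G A ∣) where

  a+k≤∣S∪NS∣ : (S : Subset (n G)) → ∣ S ∣ ≡ a → a + k ≤ ∣ S ∪ N G S ∣
  a+k≤∣S∪NS∣ S ∣S∣≡a = subst (a + k ≤_) (sym (∣p∪[q─p]∣≡∣p∣+∣q─p∣ S _))
    (subst (λ s → s + k ≤ ∣ S ∣ + ∣ N G S ∣) ∣S∣≡a (+-monoʳ-≤ ∣ S ∣ (expanding S ∣S∣≡a)))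

  a+k≤n : a ≤ n G → a + k ≤ n G
  a+k≤n a≤n with subset-of-size a ⊤ (subst (a ≤_) (sym (∣⊤∣≡n (n G))) a≤n)
  ... | S , _ , ∣S∣≡a = ≤-trans (a+k≤∣S∪NS∣ S ∣S∣≡a) (∣p∣≤n (S ∪ N G S))

  initial-LargeCopFree : ∀ {C₁} → a ≤ n G → ∣ C₁ ∣ ≤ k → LargeCopFree G a C₁ (λ u → u ∉ C₁)
  initial-LargeCopFree {C₁} a≤n ∣C₁∣≤k =
    ⊤ ─ C₁ ,
    a+k≤∣p∣⇒∣q∣≤k⇒a≤∣p─q∣ ⊤ C₁ (subst (a + k ≤_) (sym (∣⊤∣≡n (n G))) (a+k≤n a≤n)) ∣C₁∣≤k ,
    x∈p─q⇒x∉q ⊤ C₁ , x∈p─q⇒x∉q ⊤ C₁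

  step-LargeCopFree : ∀ {C C′ A} → ∣ C′ ∣ ≤ k →
                      LargeCopFree G a C A → LargeCopFree G a C′ (step G C C′ A)
  step-LargeCopFree {C′ = C′} ∣C′∣≤k (S , a≤∣S∣ , S⊆A , S∩C≡∅)
    with subset-of-size a S a≤∣S∣
  ... | S₀ , S₀⊆S , ∣S₀∣≡a =
    T ─ C′ ,
    a+k≤∣p∣⇒∣q∣≤k⇒a≤∣p─q∣ T C′ (a+k≤∣S∪NS∣ S₀ ∣S₀∣≡a) ∣C′∣≤k ,
    closure─C′⊆step G S₀ (S⊆A ∘′ S₀⊆S) (S∩C≡∅ ∘′ S₀⊆S) ,
    x∈p─q⇒x∉q T C′
    where T = S₀ ∪ N G S₀

  territory-nonempty : ∀ {C A} Cs → 1 ≤ a → All (λ C′ → ∣ C′ ∣ ≤ k) Cs →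
                       LargeCopFree G a C A → ∃ (territory G C A Cs)
  territory-nonempty []        1≤a []             (S , a≤∣S∣ , S⊆A , _) =
    let u , u∈S = 0<∣p∣⇒Nonempty S (≤-trans 1≤a a≤∣S∣) in u , S⊆A u∈S
  territory-nonempty (C′ ∷ Cs) 1≤a (∣C′∣≤k ∷ Cs≤k) inv =
    territory-nonempty Cs 1≤a Cs≤k (step-LargeCopFree ∣C′∣≤k inv)

lemma4p2 : (G : Graph) (a k : ℕ) → 1 ≤ a → 1 ≤ k → a ≤ n G →
    ((A : Subset (n G)) → ∣ A ∣ ≡ a → k ≤ ∣ N G A ∣) →
    bcw₁> G k
lemma4p2 G a k 1≤a _ a≤n expanding C₁ Cs winning with cops C₁ Cs ≤? k
... | no  cops≰k = ≰⇒> cops≰k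
... | yes cops≤k =
  let ∣C₁∣≤k , Cs≤k = cops≤k⇒All≤k C₁ Cs cops≤k
      u , u∈A = territory-nonempty G a k expanding Cs 1≤a Cs≤k
                  (initial-LargeCopFree G a k expanding a≤n ∣C₁∣≤k)
  in  ⊥-elim (winning u u∈A)
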